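{- Let $\mathcal{CH}$ be the class of chordal graphs. Then $R_1^{\mathcal{CH}}(4,j)=2j-2$ for all $j\ge 3$.
   Context: All graphs are finite and simple. A graph is chordal if it has no induced cycle of length at least four. For a graph $G$ and an integer $k\ge 0$, a set $S\subseteq V(G)$ is $k$-sparse if every vertex of $S$ has at most $k$ neighbours in $S$, and $k$-dense if every vertex of $S$ is non-adjacent to at most $k$ other vertices of $S$. A $k$-sparse (resp. $k$-dense) $j$-set is a $k$-sparse (resp. $k$-dense) set of exactly $j$ vertices. For a graph class $\mathcal{G}$, $R_k^{\mathcal{G}}(i,j)$ is the smallest $n$ such that every graph in $\mathcal{G}$ on $n$ vertices has a $k$-dense $i$-set or a $k$-sparse $j$-set. -}

module Defs where

open import Data.Nat using (ℕ; zero; suc; _+_; _∸_; _*_; _≤_; _<_; _%_)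
open import Data.Fin using (Fin; toℕ)
open import Data.Fin.Subset using (Subset; _∈_; _∩_; ∣_∣)
open import Data.Bool using (Bool; true; false; not; _∧_; T)
open import Data.Vec using (tabulate)
open import Data.Product using (Σ; _×_; ∃)
open import Data.Sum using (_⊎_)
open import Relation.Nullary using (¬_)
open import Relation.Binary.PropositionalEquality using (_≡_)
open import Function.Definitions using (Injective)
open import Data.Fin using (_≟_)
open import Relation.Nullary.Decidable using (⌊_⌋)

record Graph (n : ℕ) : Set where
  field
    adj     : Fin n → Fin n → Bool
    sym     : ∀ u v → adj u v ≡ adj v u
    irrefl  : ∀ v → adj v v ≡ false
open Graph public

CycAdj : (m : ℕ) → Fin (4 + m) → Fin (4 + m) → Set
CycAdj m i j = (suc (toℕ i) % (4 + m) ≡ toℕ j) ⊎ (suc (toℕ j) % (4 + m) ≡ toℕ i)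

InducedCycle : ∀ {n} → Graph n → (m : ℕ) → Set
InducedCycle {n} G m =
  Σ (Fin (4 + m) → Fin n) λ c →
    Injective _≡_ _≡_ c ×
    (∀ i j → (T (adj G (c i) (c j)) → CycAdj m i j) × (CycAdj m i j → T (adj G (c i) (c j))))

Chordal : ∀ {n} → Graph n → Set
Chordal G = ∀ m → ¬ InducedCycle G m

Nbhd : ∀ {n} → Graph n → Fin n → Subset n
Nbhd G v = tabulate (λ u → adj G v u)

NonNbhd : ∀ {n} → Graph n → Fin n → Subset n
NonNbhd G v = tabulate (λ u → not (adj G v u) ∧ not ⌊ u ≟ v ⌋)

Sparse : ∀ {n} → Graph n → ℕ → Subset n → Set
Sparse G k S = ∀ v → v ∈ S → ∣ S ∩ Nbhd G v ∣ ≤ k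

Dense : ∀ {n} → Graph n → ℕ → Subset n → Set
Dense G k S = ∀ v → v ∈ S → ∣ S ∩ NonNbhd G v ∣ ≤ k

RamseyCH : ℕ → ℕ → ℕ → ℕ → Set
RamseyCH k i j n =
  (G : Graph n) → Chordal G →
    (∃ λ S → ∣ S ∣ ≡ i × Dense G k S) ⊎ (∃ λ S → ∣ S ∣ ≡ j × Sparse G k S)

RCH≡ : ℕ → ℕ → ℕ → ℕ → Set
RCH≡ k i j n = RamseyCH k i j n × (∀ m → m < n → ¬ RamseyCH k i j m)

-- If a chordal graph contains a 4-cycle, not necessarily induced, its four vertices form a
-- 1-dense set.  Otherwise a chord of any longer cycle would split it into shorter cycles, one
-- still of length at least four, so every cycle is a triangle and the graph always has a leaf
-- block: an isolated vertex, a pendant edge, or two adjacent vertices whose only other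
-- neighbour is a common vertex c.  It is found at the first vertex of a path that cannot be
-- extended there.  Removing the block and keeping one, one (both if nothing else is left),
-- resp. two of its vertices gives, by induction, a 1-sparse set S ⊆ W with ∣ W ∣ < 2 ∣ S ∣;
-- for 2j - 2 vertices, ∣ S ∣ ≥ j.
--
-- For the lower bound, the chain of triangles on 0, 1, …, m - 1 with edges 2i ~ 2i + 1,
-- 2i + 1 ~ 2i + 2 and 2i + 1 ~ 2i + 3 is chordal, as the smaller neighbours of any vertex are
-- adjacent.  It has no 1-dense 4-set, and a 1-sparse set containing both 2i and 2i + 1 misses
-- 2i + 2 and 2i + 3, so it has at most (m + 2) / 2 vertices.

module Submission where

open import Data.Bool using (Bool; true; false; T; not; _∧_; _∨_)
open import Data.Bool.Properties using (T-≡; T-∨; ∨-comm)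
open import Data.Empty using (⊥; ⊥-elim)
open import Data.Fin using (Fin; zero; suc; toℕ; fromℕ<; _≟_)
open import Data.Fin.Properties using (any?; toℕ-injective; toℕ<n; toℕ-fromℕ<; injective⇒≤)
open import Data.Fin.Subset
  using (Subset; inside; outside; _∈_; _∉_; _⊆_; _∪_; _∩_; _─_; ⁅_⁆; ∣_∣; Nonempty)
  renaming (⊥ to ∅; ⊤ to full)
open import Data.Fin.Subset.Properties
open import Data.List using (allFin)
import Data.List.Extrema.Nat as Extrema
open import Data.List.Membership.Propositional.Properties using (∈-allFin)
import Data.List.Relation.Unary.All as All
open import Data.Nat using (ℕ; zero; suc; _+_; _*_; _∸_; _%_; _≤_; _<_; _≤?_; z≤n; s≤s; NonZero)
  renaming (_≟_ to _≟ℕ_)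
open import Data.Nat.DivMod using (m<n⇒m%n≡m; n%n≡0)
open import Data.Nat.Induction using (<-rec)
open import Data.Nat.Properties hiding (_≟_)
open import Data.Product using (Σ-syntax; ∃; ∃₂; _×_; _,_; proj₁; proj₂)
open import Data.Sum using (_⊎_; inj₁; inj₂; [_,_])
import Data.Sum as Sum
open import Data.Vec using ([]; _∷_; tabulate; here; there)
open import Data.Vec.Properties using (lookup∘tabulate; lookup⇒[]=; []=⇒lookup; tabulate-cong)
open import Function.Base using (_∘_)
open import Function.Bundles using (Equivalence)
open import Function.Definitions using (Injective)
open import Relation.Binary.Definitions using (tri<; tri≈; tri>)
open import Relation.Binary.PropositionalEquality
  using (_≡_; _≢_; ≢-sym; refl; sym; trans; cong; cong₂; subst; subst₂)
open import Relation.Nullary using (¬_; Dec; yes; no; contradiction; ¬?; _×-dec_; _⊎-dec_)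
open import Relation.Nullary.Decidable using (T?; ⌊_⌋; map′)

open import Defs hiding (sym)

∣p∪q∣≤∣p∣+∣q∣ : ∀ {n} (p q : Subset n) → ∣ p ∪ q ∣ ≤ ∣ p ∣ + ∣ q ∣
∣p∪q∣≤∣p∣+∣q∣ []            []            = z≤n
∣p∪q∣≤∣p∣+∣q∣ (outside ∷ p) (outside ∷ q) = ∣p∪q∣≤∣p∣+∣q∣ p q
∣p∪q∣≤∣p∣+∣q∣ (outside ∷ p) (inside  ∷ q) =
  ≤-trans (s≤s (∣p∪q∣≤∣p∣+∣q∣ p q)) (≤-reflexive (sym (+-suc ∣ p ∣ ∣ q ∣)))
∣p∪q∣≤∣p∣+∣q∣ (inside  ∷ p) (s       ∷ q) =
  s≤s (≤-trans (∣p∪q∣≤∣p∣+∣q∣ p q) (+-monoʳ-≤ ∣ p ∣ (∣p∣≤∣x∷p∣ s q)))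

∣p∪q∣≡∣p∣+∣q∣ : ∀ {n} {p q : Subset n} → (∀ {x} → x ∈ p → x ∉ q) → ∣ p ∪ q ∣ ≡ ∣ p ∣ + ∣ q ∣
∣p∪q∣≡∣p∣+∣q∣ {p = []}          {[]}          _ = refl
∣p∪q∣≡∣p∣+∣q∣ {p = inside  ∷ p} {inside  ∷ q} disjoint = contradiction here (disjoint here)
∣p∪q∣≡∣p∣+∣q∣ {p = inside  ∷ p} {outside ∷ q} disjoint =
  cong suc (∣p∪q∣≡∣p∣+∣q∣ λ x∈p x∈q → disjoint (there x∈p) (there x∈q))
∣p∪q∣≡∣p∣+∣q∣ {p = outside ∷ p} {inside  ∷ q} disjoint =
  trans (cong suc (∣p∪q∣≡∣p∣+∣q∣ λ x∈p x∈q → disjoint (there x∈p) (there x∈q)))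
        (sym (+-suc ∣ p ∣ ∣ q ∣))
∣p∪q∣≡∣p∣+∣q∣ {p = outside ∷ p} {outside ∷ q} disjoint =
  ∣p∪q∣≡∣p∣+∣q∣ λ x∈p x∈q → disjoint (there x∈p) (there x∈q)

x∈p─q⇒x∉q : ∀ {n} {x : Fin n} (p q : Subset n) → x ∈ p ─ q → x ∉ q
x∈p─q⇒x∉q (_ ∷ p) (inside  ∷ q) (there x∈p─q) (there x∈q) = x∈p─q⇒x∉q p q x∈p─q x∈q
x∈p─q⇒x∉q (_ ∷ p) (outside ∷ q) (there x∈p─q) (there x∈q) = x∈p─q⇒x∉q p q x∈p─q x∈q

∣p∣≤∣p─q∣+∣q∣ : ∀ {n} (p q : Subset n) → ∣ p ∣ ≤ ∣ p ─ q ∣ + ∣ q ∣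
∣p∣≤∣p─q∣+∣q∣ p q = ≤-trans (p⊆q⇒∣p∣≤∣q∣ p⊆[p─q]∪q) (∣p∪q∣≤∣p∣+∣q∣ (p ─ q) q)
  where
  p⊆[p─q]∪q : p ⊆ (p ─ q) ∪ q
  p⊆[p─q]∪q {x} x∈p with x ∈? q
  ... | yes x∈q = x∈p∪q⁺ (inj₂ x∈q)
  ... | no  x∉q = x∈p∪q⁺ (inj₁ (x∈p∧x∉q⇒x∈p─q x∈p x∉q))

∣p∣≤1 : ∀ {n} {p : Subset n} (u : Fin n) → (∀ {x} → x ∈ p → x ≡ u) → ∣ p ∣ ≤ 1
∣p∣≤1 u only-u = ≤-trans (p⊆q⇒∣p∣≤∣q∣ λ x∈p → subst (_∈ ⁅ u ⁆) (sym (only-u x∈p)) (x∈⁅x⁆ u))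
                         (≤-reflexive (∣⁅x⁆∣≡1 u))

⁅x⁆⊆ : ∀ {n} {x : Fin n} {p : Subset n} → x ∈ p → ⁅ x ⁆ ⊆ p
⁅x⁆⊆ {x = x} x∈p y∈⁅x⁆ = subst (_∈ _) (sym (x∈⁅y⁆⇒x≡y x y∈⁅x⁆)) x∈p

x∈p⇒0<∣p∣ : ∀ {n} {x : Fin n} {p : Subset n} → x ∈ p → 0 < ∣ p ∣
x∈p⇒0<∣p∣ {x = x} x∈p = ≤-trans (≤-reflexive (sym (∣⁅x⁆∣≡1 x))) (p⊆q⇒∣p∣≤∣q∣ (⁅x⁆⊆ x∈p))

0<∣p∣⇒Nonempty : ∀ {n} {p : Subset n} → 0 < ∣ p ∣ → Nonempty p
0<∣p∣⇒Nonempty {n} {p} 0<∣p∣ with nonempty? p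
... | yes nonempty = nonempty
... | no  empty    = contradiction (trans (cong ∣_∣ (Empty-unique empty)) (∣⊥∣≡0 n)) (>⇒≢ 0<∣p∣)

⊆-of-size : ∀ {n} (p : Subset n) {k} → k ≤ ∣ p ∣ → ∃ λ q → q ⊆ p × ∣ q ∣ ≡ k
⊆-of-size {n} p {zero} _ = ∅ , ⊆-min p , ∣⊥∣≡0 n
⊆-of-size (outside ∷ p) {suc k} k≤∣p∣ with ⊆-of-size p k≤∣p∣
... | q , q⊆p , ∣q∣≡k = outside ∷ q , out⊆ q⊆p , ∣q∣≡k
⊆-of-size (inside ∷ p) {suc k} (s≤s k≤∣p∣) with ⊆-of-size p k≤∣p∣
... | q , q⊆p , ∣q∣≡k = inside ∷ q , in⊆in q⊆p , cong suc ∣q∣≡k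

∣⁅x⁆∪p∣≡1+∣p∣ : ∀ {n} {x : Fin n} {p : Subset n} → x ∉ p → ∣ ⁅ x ⁆ ∪ p ∣ ≡ suc ∣ p ∣
∣⁅x⁆∪p∣≡1+∣p∣ {x = x} {p} x∉p =
  trans (∣p∪q∣≡∣p∣+∣q∣ λ y∈⁅x⁆ → subst (_∉ p) (sym (x∈⁅y⁆⇒x≡y x y∈⁅x⁆)) x∉p)
        (cong (_+ ∣ p ∣) (∣⁅x⁆∣≡1 x))

∣⁅x⁆∪⁅y⁆∣≡2 : ∀ {n} {x y : Fin n} → x ≢ y → ∣ ⁅ x ⁆ ∪ ⁅ y ⁆ ∣ ≡ 2
∣⁅x⁆∪⁅y⁆∣≡2 {y = y} x≢y = trans (∣⁅x⁆∪p∣≡1+∣p∣ (x≢y⇒x∉⁅y⁆ x≢y)) (cong suc (∣⁅x⁆∣≡1 y))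

x∉⁅y⁆∪p : ∀ {n} {x y : Fin n} {p : Subset n} → x ≢ y → x ∉ p → x ∉ ⁅ y ⁆ ∪ p
x∉⁅y⁆∪p {y = y} {p} x≢y x∉p x∈ = [ x≢y ∘ x∈⁅y⁆⇒x≡y y , x∉p ] (x∈p∪q⁻ ⁅ y ⁆ p x∈)

∪⊆ : ∀ {n} {p q r : Subset n} → p ⊆ r → q ⊆ r → p ∪ q ⊆ r
∪⊆ {p = p} {q} p⊆r q⊆r x∈ = [ p⊆r , q⊆r ] (x∈p∪q⁻ p q x∈)

∈tabulate⁺ : ∀ {n} {f : Fin n → Bool} {x} → f x ≡ true → x ∈ tabulate f
∈tabulate⁺ {f = f} {x} fx = lookup⇒[]= x (tabulate f) (trans (lookup∘tabulate f x) fx)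

∈tabulate⁻ : ∀ {n} {f : Fin n → Bool} {x} → x ∈ tabulate f → f x ≡ true
∈tabulate⁻ {f = f} {x} x∈ = trans (sym (lookup∘tabulate f x)) ([]=⇒lookup x∈)

w+r<2*[s+b] : ∀ {w r s b} → w < 2 * s ⊎ w ≡ 0 → r < 2 * b ⊎ (r ≤ 2 * b × w ≢ 0) → w + r < 2 * (s + b)
w+r<2*[s+b] {w} {r} {s} {b} large gain = subst (w + r <_) (sym (*-distribˡ-+ 2 s b)) (sum< large gain)
  where
  sum< : w < 2 * s ⊎ w ≡ 0 → r < 2 * b ⊎ (r ≤ 2 * b × w ≢ 0) → w + r < 2 * s + 2 * b
  sum< (inj₁ w<2s)  (inj₁ r<2b)       = +-mono-≤-< (<⇒≤ w<2s) r<2b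
  sum< (inj₂ refl)  (inj₁ r<2b)       = +-mono-≤-< (z≤n {2 * s}) r<2b
  sum< (inj₁ w<2s)  (inj₂ (r≤2b , _)) = +-mono-<-≤ w<2s r≤2b
  sum< (inj₂ w≡0)   (inj₂ (_ , w≢0))  = contradiction w≡0 w≢0

Successor : ℕ → ℕ → ℕ → Set
Successor L i j = suc i ≡ j ⊎ (suc i ≡ L × j ≡ 0)

Consecutive : ℕ → ℕ → ℕ → Set
Consecutive L i j = Successor L i j ⊎ Successor L j i

consecutive? : ∀ L i j → Dec (Consecutive L i j)
consecutive? L i j = successor? i j ⊎-dec successor? j i
  where
  successor? : ∀ i j → Dec (Successor L i j)
  successor? i j = (suc i ≟ℕ j) ⊎-dec ((suc i ≟ℕ L) ×-dec (j ≟ℕ 0))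

%⇒Successor : ∀ {L i j} .{{_ : NonZero L}} → i < L → suc i % L ≡ j → Successor L i j
%⇒Successor {L} i<L eq with m≤n⇒m<n∨m≡n i<L
... | inj₁ 1+i<L = inj₁ (trans (sym (m<n⇒m%n≡m 1+i<L)) eq)
... | inj₂ 1+i≡L = inj₂ (1+i≡L , trans (sym eq) (trans (cong (_% L) 1+i≡L) (n%n≡0 L)))

Successor⇒% : ∀ {L i j} .{{_ : NonZero L}} → j < L → Successor L i j → suc i % L ≡ j
Successor⇒% j<L (inj₁ refl)          = m<n⇒m%n≡m j<L
Successor⇒% {L} _ (inj₂ (1+i≡L , refl)) = trans (cong (_% L) 1+i≡L) (n%n≡0 L)

CycAdj⇒Consecutive : ∀ m {i j : Fin (4 + m)} → CycAdj m i j → Consecutive (4 + m) (toℕ i) (toℕ j)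
CycAdj⇒Consecutive m {i} {j} =
  Sum.map (%⇒Successor (toℕ<n i)) (%⇒Successor (toℕ<n j))

Consecutive⇒CycAdj : ∀ m {i j : Fin (4 + m)} → Consecutive (4 + m) (toℕ i) (toℕ j) → CycAdj m i j
Consecutive⇒CycAdj m {i} {j} =
  Sum.map (Successor⇒% (toℕ<n j)) (Successor⇒% (toℕ<n i))

argmax : ∀ {L} (f : Fin (suc L) → ℕ) → ∃ λ i → ∀ j → f j ≤ f i
argmax {L} f = i , λ j → All.lookup (Extrema.f[xs]≤f[argmax] {f = f} zero (allFin (suc L))) (∈-allFin j)
  where
  i : Fin (suc L)
  i = Extrema.argmax f zero (allFin (suc L))

cycle-neighbours-ℕ : ∀ m t → t < 4 + m → ∃₂ λ p q → p < 4 + m × q < 4 + m ×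
         Successor (4 + m) p t × Successor (4 + m) t q × p ≢ q × ¬ Consecutive (4 + m) p q
cycle-neighbours-ℕ m zero _ = 3 + m , 1 , ≤-refl , s≤s (s≤s z≤n) , inj₂ (refl , refl) , inj₁ refl , (λ ()) ,
  λ { (inj₁ (inj₁ ())) ; (inj₁ (inj₂ (_ , ()))) ; (inj₂ (inj₁ ())) ; (inj₂ (inj₂ (() , _))) }
cycle-neighbours-ℕ m (suc t) 1+t<L with m≤n⇒m<n∨m≡n 1+t<L
... | inj₁ 2+t<L = t , 2 + t , <-trans (n<1+n t) 1+t<L , 2+t<L , inj₁ refl , inj₁ refl ,
  m≢1+n+m t , not-consecutive
  where
  not-consecutive : ¬ Consecutive (4 + m) t (2 + t)
  not-consecutive (inj₁ (inj₁ 1+t≡2+t))   = 1+n≢n (sym (suc-injective 1+t≡2+t))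
  not-consecutive (inj₂ (inj₁ 3+t≡t))     = m≢1+n+m t (sym 3+t≡t)
  not-consecutive (inj₂ (inj₂ (eq , refl))) = contradiction eq λ ()
... | inj₂ 2+t≡L = t , 0 , <-trans (n<1+n t) 1+t<L , s≤s z≤n , inj₁ refl , inj₂ (2+t≡L , refl) ,
  t≢0 , not-consecutive
  where
  t≡2+m : t ≡ 2 + m
  t≡2+m = suc-injective (suc-injective 2+t≡L)
  t≢0 : t ≢ 0
  t≢0 t≡0 = contradiction (trans (sym t≡2+m) t≡0) λ ()
  not-consecutive : ¬ Consecutive (4 + m) t 0
  not-consecutive (inj₁ (inj₁ ()))
  not-consecutive (inj₁ (inj₂ (1+t≡L , _))) = 1+n≢n (sym (trans 1+t≡L (sym 2+t≡L)))
  not-consecutive (inj₂ (inj₁ 1≡t))         = contradiction (trans 1≡t t≡2+m) λ ()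
  not-consecutive (inj₂ (inj₂ (() , _)))

cycle-neighbours : ∀ m (i : Fin (4 + m)) → ∃₂ λ p q → CycAdj m p i × CycAdj m i q × p ≢ q × ¬ CycAdj m p q
cycle-neighbours m i = from-ℕ (cycle-neighbours-ℕ m (toℕ i) (toℕ<n i))
  where
  from-ℕ : (∃₂ λ p q → p < 4 + m × q < 4 + m × Successor (4 + m) p (toℕ i) × Successor (4 + m) (toℕ i) q ×
                       p ≢ q × ¬ Consecutive (4 + m) p q) →
           ∃₂ λ p q → CycAdj m p i × CycAdj m i q × p ≢ q × ¬ CycAdj m p q
  from-ℕ (p , q , p<L , q<L , p→i , i→q , p≢q , p≁q) = fromℕ< p<L , fromℕ< q<L ,
    Consecutive⇒CycAdj m (inj₁ (subst (λ x → Successor (4 + m) x (toℕ i)) (sym (toℕ-fromℕ< p<L)) p→i)) ,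
    Consecutive⇒CycAdj m (inj₁ (subst (Successor (4 + m) (toℕ i)) (sym (toℕ-fromℕ< q<L)) i→q)) ,
    (λ eq → p≢q (trans (sym (toℕ-fromℕ< p<L)) (trans (cong toℕ eq) (toℕ-fromℕ< q<L)))) ,
    λ p–q → p≁q (subst₂ (Consecutive (4 + m)) (toℕ-fromℕ< p<L) (toℕ-fromℕ< q<L) (CycAdj⇒Consecutive m p–q))

skip : ℕ → ℕ → ℕ
skip _       zero    = zero
skip zero    (suc i) = suc (suc i)
skip (suc a) (suc i) = suc (skip a i)

skip-below : ∀ {a i} → i ≤ a → skip a i ≡ i
skip-below {i = zero}  _         = refl
skip-below {suc a} {suc i} (s≤s i≤a) = cong suc (skip-below i≤a)

skip-above : ∀ {a i} → a < i → skip a i ≡ suc i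
skip-above {zero}  {suc i} _         = refl
skip-above {suc a} {suc i} (s≤s a<i) = cong suc (skip-above a<i)

skip≤suc : ∀ a i → skip a i ≤ suc i
skip≤suc _       zero    = z≤n
skip≤suc zero    (suc i) = ≤-refl
skip≤suc (suc a) (suc i) = s≤s (skip≤suc a i)

skip-injective : ∀ a {i j} → skip a i ≡ skip a j → i ≡ j
skip-injective _       {zero}  {zero}  _  = refl
skip-injective zero    {suc i} {suc j} eq = cong suc (suc-injective (suc-injective eq))
skip-injective (suc a) {suc i} {suc j} eq = cong suc (skip-injective a (suc-injective eq))
skip-injective zero    {zero}  {suc _} ()
skip-injective (suc _) {zero}  {suc _} ()
skip-injective zero    {suc _} {zero}  ()
skip-injective (suc _) {suc _} {zero}  ()

module _ {n : ℕ} (G : Graph n) where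

  infix 4 _~_ _~?_

  _~_ : Fin n → Fin n → Set
  u ~ v = T (adj G u v)

  _~?_ : ∀ u v → Dec (u ~ v)
  u ~? v = T? (adj G u v)

  ~-sym : ∀ {u v} → u ~ v → v ~ u
  ~-sym {u} {v} = subst T (Graph.sym G u v)

  ~-irrefl : ∀ {v} → ¬ v ~ v
  ~-irrefl {v} = subst T (irrefl G v)

  ~⇒≢ : ∀ {u v} → u ~ v → u ≢ v
  ~⇒≢ u~v refl = ~-irrefl u~v

  ∈Nbhd⁺ : ∀ {v x} → v ~ x → x ∈ Nbhd G v
  ∈Nbhd⁺ v~x = ∈tabulate⁺ (Equivalence.to T-≡ v~x)

  ∈Nbhd⁻ : ∀ {v x} → x ∈ Nbhd G v → v ~ x
  ∈Nbhd⁻ x∈ = Equivalence.from T-≡ (∈tabulate⁻ x∈)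

  ∈NonNbhd⁺ : ∀ {v x} → ¬ v ~ x → x ≢ v → x ∈ NonNbhd G v
  ∈NonNbhd⁺ {v} {x} v≁x x≢v = ∈tabulate⁺ (entry (adj G v x) v≁x (x ≟ v) x≢v)
    where
    entry : ∀ b → ¬ T b → (d : Dec (x ≡ v)) → x ≢ v → not b ∧ not ⌊ d ⌋ ≡ true
    entry false _ (no _)  _   = refl
    entry true  ¬b _      _   = contradiction _ ¬b
    entry false _ (yes x≡v) x≢v = contradiction x≡v x≢v

  ∈NonNbhd⁻ : ∀ {v x} → x ∈ NonNbhd G v → ¬ v ~ x × x ≢ v
  ∈NonNbhd⁻ {v} {x} x∈ = entry (adj G v x) (x ≟ v) (∈tabulate⁻ x∈)
    where
    entry : ∀ b (d : Dec (x ≡ v)) → not b ∧ not ⌊ d ⌋ ≡ true → ¬ T b × x ≢ v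
    entry false (no x≢v) _ = (λ ()) , x≢v

  Sparse-antitone : ∀ {k S S′} → S′ ⊆ S → Sparse G k S → Sparse G k S′
  Sparse-antitone {S = S} {S′} S′⊆S sparse v v∈S′ =
    ≤-trans (p⊆q⇒∣p∣≤∣q∣ S′∩N⊆S∩N) (sparse v (S′⊆S v∈S′))
    where
    S′∩N⊆S∩N : S′ ∩ Nbhd G v ⊆ S ∩ Nbhd G v
    S′∩N⊆S∩N x∈ with x∈p∩q⁻ S′ _ x∈
    ... | x∈S′ , x∈N = x∈p∩q⁺ (S′⊆S x∈S′ , x∈N)

  Sparse-∪ : ∀ {k S S′} → Sparse G k S → Sparse G k S′ →
             (∀ {x y} → x ∈ S → y ∈ S′ → ¬ x ~ y) → Sparse G k (S ∪ S′)
  Sparse-∪ {S = S} {S′} sparse sparse′ no-edge v v∈S∪S′ with x∈p∪q⁻ S S′ v∈S∪S′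
  ... | inj₁ v∈S  = ≤-trans (p⊆q⇒∣p∣≤∣q∣ (drop-S′ v∈S)) (sparse v v∈S)
    where
    drop-S′ : v ∈ S → (S ∪ S′) ∩ Nbhd G v ⊆ S ∩ Nbhd G v
    drop-S′ v∈S x∈ with x∈p∩q⁻ (S ∪ S′) _ x∈
    ... | x∈S∪S′ , x∈N with x∈p∪q⁻ S S′ x∈S∪S′
    ...   | inj₁ x∈S  = x∈p∩q⁺ (x∈S , x∈N)
    ...   | inj₂ x∈S′ = contradiction (∈Nbhd⁻ x∈N) (no-edge v∈S x∈S′)
  ... | inj₂ v∈S′ = ≤-trans (p⊆q⇒∣p∣≤∣q∣ drop-S) (sparse′ v v∈S′)
    where
    drop-S : (S ∪ S′) ∩ Nbhd G v ⊆ S′ ∩ Nbhd G v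
    drop-S x∈ with x∈p∩q⁻ (S ∪ S′) _ x∈
    ... | x∈S∪S′ , x∈N with x∈p∪q⁻ S S′ x∈S∪S′
    ...   | inj₁ x∈S  = contradiction (~-sym (∈Nbhd⁻ x∈N)) (no-edge x∈S v∈S′)
    ...   | inj₂ x∈S′ = x∈p∩q⁺ (x∈S′ , x∈N)

  ∣S∣≤2⇒Sparse : ∀ {S} → ∣ S ∣ ≤ 2 → Sparse G 1 S
  ∣S∣≤2⇒Sparse {S} ∣S∣≤2 v v∈S =
    ≤-pred (≤-trans (s≤s (p⊆q⇒∣p∣≤∣q∣ S∩N⊆S-v)) (≤-trans (x∈p⇒∣p-x∣<∣p∣ v∈S) ∣S∣≤2))
    where
    S∩N⊆S-v : S ∩ Nbhd G v ⊆ S ─ ⁅ v ⁆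
    S∩N⊆S-v x∈ with x∈p∩q⁻ S _ x∈
    ... | x∈S , x∈N = x∈p∧x≢y⇒x∈p-y x∈S (≢-sym (~⇒≢ (∈Nbhd⁻ x∈N)))

  Dense⇒∣S∣≤2+degree : ∀ {S v} → Dense G 1 S → v ∈ S → ∣ S ∣ ≤ 2 + ∣ S ∩ Nbhd G v ∣
  Dense⇒∣S∣≤2+degree {S} {v} dense v∈S = begin
    ∣ S ∣                                                ≤⟨ p⊆q⇒∣p∣≤∣q∣ split ⟩
    ∣ ⁅ v ⁆ ∪ (S ∩ NonNbhd G v) ∪ (S ∩ Nbhd G v) ∣       ≤⟨ ∣p∪q∣≤∣p∣+∣q∣ ⁅ v ⁆ _ ⟩
    ∣ ⁅ v ⁆ ∣ + ∣ (S ∩ NonNbhd G v) ∪ (S ∩ Nbhd G v) ∣   ≤⟨ +-mono-≤ (≤-reflexive (∣⁅x⁆∣≡1 v))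
                                                              (∣p∪q∣≤∣p∣+∣q∣ (S ∩ NonNbhd G v) _) ⟩
    1 + (∣ S ∩ NonNbhd G v ∣ + ∣ S ∩ Nbhd G v ∣)          ≤⟨ s≤s (+-monoˡ-≤ _ (dense v v∈S)) ⟩
    2 + ∣ S ∩ Nbhd G v ∣                                 ∎
    where
    open ≤-Reasoning
    split : S ⊆ ⁅ v ⁆ ∪ (S ∩ NonNbhd G v) ∪ (S ∩ Nbhd G v)
    split {x} x∈S with x ≟ v | v ~? x
    ... | yes refl | _       = x∈p∪q⁺ (inj₁ (x∈⁅x⁆ x))
    ... | no  x≢v  | yes v~x = x∈p∪q⁺ (inj₂ (x∈p∪q⁺ (inj₂ (x∈p∩q⁺ (x∈S , ∈Nbhd⁺ v~x)))))
    ... | no  x≢v  | no  v≁x = x∈p∪q⁺ (inj₂ (x∈p∪q⁺ (inj₁ (x∈p∩q⁺ (x∈S , ∈NonNbhd⁺ v≁x x≢v)))))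

  record FourCycle : Set where
    field
      a b c d : Fin n
      a~b : a ~ b
      b~c : b ~ c
      c~d : c ~ d
      d~a : d ~ a
      a≢c : a ≢ c
      b≢d : b ≢ d

  fourCycle? : Dec FourCycle
  fourCycle? = map′
    (λ (a , b , c , d , a~b , b~c , c~d , d~a , a≢c , b≢d) → record
      { a = a ; b = b ; c = c ; d = d ; a~b = a~b ; b~c = b~c ; c~d = c~d ; d~a = d~a
      ; a≢c = a≢c ; b≢d = b≢d })
    (λ C → let open FourCycle C in a , b , c , d , a~b , b~c , c~d , d~a , a≢c , b≢d)
    (any? λ a → any? λ b → any? λ c → any? λ d →
      (a ~? b) ×-dec (b ~? c) ×-dec (c ~? d) ×-dec (d ~? a) ×-dec ¬? (a ≟ c) ×-dec ¬? (b ≟ d))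

  rotate : FourCycle → FourCycle
  rotate C = record
    { a = b ; b = c ; c = d ; d = a ; a~b = b~c ; b~c = c~d ; c~d = d~a ; d~a = a~b
    ; a≢c = b≢d ; b≢d = a≢c ∘ sym }
    where open FourCycle C

  Corner : FourCycle → Fin n → Set
  Corner C x = x ≡ a ⊎ x ≡ b ⊎ x ≡ c ⊎ x ≡ d
    where open FourCycle C

  corner-rotate : ∀ C {x} → Corner C x → Corner (rotate C) x
  corner-rotate _ = [ inj₂ ∘ inj₂ ∘ inj₂ , [ inj₁ , [ inj₂ ∘ inj₁ , inj₂ ∘ inj₂ ∘ inj₁ ] ] ]

  opposite : ∀ C {x} → Corner C x → ¬ FourCycle.a C ~ x → x ≢ FourCycle.a C → x ≡ FourCycle.c C
  opposite C (inj₁ x≡a)                 _   x≢a = contradiction x≡a x≢a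
  opposite C (inj₂ (inj₁ refl))         a≁x _   = contradiction (FourCycle.a~b C) a≁x
  opposite C (inj₂ (inj₂ (inj₁ x≡c)))   _   _   = x≡c
  opposite C (inj₂ (inj₂ (inj₂ refl)))  a≁x _   = contradiction (~-sym (FourCycle.d~a C)) a≁x

  FourCycle⇒dense : FourCycle → ∃ λ S → ∣ S ∣ ≡ 4 × Dense G 1 S
  FourCycle⇒dense C = corners , size , dense
    where
    open FourCycle C
    corners : Subset n
    corners = ⁅ a ⁆ ∪ ⁅ b ⁆ ∪ ⁅ c ⁆ ∪ ⁅ d ⁆

    size : ∣ corners ∣ ≡ 4
    size = trans (∣⁅x⁆∪p∣≡1+∣p∣ (x∉⁅y⁆∪p (~⇒≢ a~b) (x∉⁅y⁆∪p a≢c (x≢y⇒x∉⁅y⁆ (≢-sym (~⇒≢ d~a))))))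
          (cong suc (trans (∣⁅x⁆∪p∣≡1+∣p∣ (x∉⁅y⁆∪p (~⇒≢ b~c) (x≢y⇒x∉⁅y⁆ b≢d)))
          (cong suc (trans (∣⁅x⁆∪p∣≡1+∣p∣ (x≢y⇒x∉⁅y⁆ (~⇒≢ c~d))) (cong suc (∣⁅x⁆∣≡1 d))))))

    corner : ∀ {x} → x ∈ corners → Corner C x
    corner x∈ with x∈p∪q⁻ ⁅ a ⁆ _ x∈
    ... | inj₁ x∈a = inj₁ (x∈⁅y⁆⇒x≡y a x∈a)
    ... | inj₂ x∈  with x∈p∪q⁻ ⁅ b ⁆ _ x∈
    ...   | inj₁ x∈b = inj₂ (inj₁ (x∈⁅y⁆⇒x≡y b x∈b))
    ...   | inj₂ x∈  with x∈p∪q⁻ ⁅ c ⁆ _ x∈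
    ...     | inj₁ x∈c = inj₂ (inj₂ (inj₁ (x∈⁅y⁆⇒x≡y c x∈c)))
    ...     | inj₂ x∈d = inj₂ (inj₂ (inj₂ (x∈⁅y⁆⇒x≡y d x∈d)))

    -- Rotations bring each corner to the position of a, whose only non-neighbour is c.
    unique-non-neighbour : ∀ {v} → Corner C v →
      ∃ λ o → ∀ {x} → Corner C x → ¬ v ~ x → x ≢ v → x ≡ o
    unique-non-neighbour (inj₁ refl)                = c , opposite C
    unique-non-neighbour (inj₂ (inj₁ refl))         = d , opposite (rotate C) ∘ corner-rotate C
    unique-non-neighbour (inj₂ (inj₂ (inj₁ refl)))  =
      a , opposite (rotate (rotate C)) ∘ corner-rotate (rotate C) ∘ corner-rotate C
    unique-non-neighbour (inj₂ (inj₂ (inj₂ refl)))  =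
      b , opposite (rotate (rotate (rotate C)))
        ∘ corner-rotate (rotate (rotate C)) ∘ corner-rotate (rotate C) ∘ corner-rotate C

    dense : Dense G 1 corners
    dense v v∈ with unique-non-neighbour (corner v∈)
    ... | o , unique = ∣p∣≤1 o λ x∈ →
      let x∈S , x∈NN = x∈p∩q⁻ corners _ x∈
          v≁x , x≢v = ∈NonNbhd⁻ x∈NN
      in  unique (corner x∈S) v≁x x≢v

  record Path (U : Subset n) (k : ℕ) : Set where
    field
      vertex    : ℕ → Fin n
      injective : ∀ {i j} → i ≤ k → j ≤ k → vertex i ≡ vertex j → i ≡ j
      edge      : ∀ {i} → i < k → vertex i ~ vertex (suc i)
      within    : ∀ {i} → i ≤ k → vertex i ∈ U

  open Path

  -- A cycle through the k + 1 vertices of a path.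
  Cycle : Subset n → ℕ → Set
  Cycle U k = Σ[ P ∈ Path U k ] vertex P k ~ vertex P 0

  subpath : ∀ {U k} (P : Path U k) a d → d + a ≤ k → Path U d
  subpath {k = k} P a d d+a≤k = record
    { vertex    = λ i → vertex P (i + a)
    ; injective = λ i≤d j≤d eq → +-cancelʳ-≡ a _ _ (injective P (bound i≤d) (bound j≤d) eq)
    ; edge      = λ i<d → edge P (bound i<d)
    ; within    = λ i≤d → within P (bound i≤d)
    }
    where
    bound : ∀ {i} → i ≤ d → i + a ≤ k
    bound i≤d = ≤-trans (+-monoˡ-≤ a i≤d) d+a≤k

  chord⇒Cycle : ∀ {U k} (P : Path U k) {a d} → d + a ≤ k → vertex P a ~ vertex P (d + a) → Cycle U d
  chord⇒Cycle P {a} {d} d+a≤k chord = subpath P a d d+a≤k , ~-sym chord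

  bypass : ∀ {U k} (C : Cycle U (suc k)) a → 2 + a ≤ suc k →
           vertex (proj₁ C) a ~ vertex (proj₁ C) (2 + a) → Cycle U k
  bypass {U} {k} (P , closing) a 2+a≤1+k chord = P′ , closing′
    where
    v : ℕ → Fin n
    v = vertex P
    edge′ : ∀ {i} → i < k → v (skip a i) ~ v (skip a (suc i))
    edge′ {i} i<k with <-cmp i a
    ... | tri< i<a _ _ rewrite skip-below (<⇒≤ i<a) | skip-below i<a = edge P (m<n⇒m<1+n i<k)
    ... | tri≈ _ refl _ rewrite skip-below (≤-refl {i}) | skip-above (n<1+n i) = chord
    ... | tri> _ _ a<i rewrite skip-above a<i | skip-above (m<n⇒m<1+n a<i) = edge P (s≤s i<k)
    P′ : Path U k
    P′ = record
      { vertex    = v ∘ skip a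
      ; injective = λ i≤k j≤k eq →
          skip-injective a (injective P (bound i≤k) (bound j≤k) eq)
      ; edge      = edge′
      ; within    = λ i≤k → within P (bound i≤k)
      }
      where
      bound : ∀ {i} → i ≤ k → skip a i ≤ suc k
      bound {i} i≤k = ≤-trans (skip≤suc a i) (s≤s i≤k)
    closing′ : v (skip a k) ~ v 0
    closing′ rewrite skip-above {a} {k} (≤-pred 2+a≤1+k) = closing

  Cycle-3⇒FourCycle : ∀ {U} → Cycle U 3 → FourCycle
  Cycle-3⇒FourCycle (P , closing) = record
    { a = vertex P 0 ; b = vertex P 1 ; c = vertex P 2 ; d = vertex P 3
    ; a~b = edge P (s≤s z≤n) ; b~c = edge P (s≤s (s≤s z≤n)) ; c~d = edge P ≤-refl
    ; d~a = closing
    ; a≢c = λ eq → contradiction (injective P z≤n (s≤s (s≤s z≤n)) eq) λ ()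
    ; b≢d = λ eq → contradiction (injective P (s≤s z≤n) ≤-refl eq) λ ()
    }

  successor-edge : ∀ {U k} (C : Cycle U k) {i j} → j ≤ k → Successor (suc k) i j →
                   vertex (proj₁ C) i ~ vertex (proj₁ C) j
  successor-edge (P , _)       j≤k (inj₁ refl)             = edge P j≤k
  successor-edge (P , closing) _   (inj₂ (1+i≡1+k , refl)) rewrite suc-injective 1+i≡1+k = closing

  Chordless : ∀ {U k} → Cycle U k → Set
  Chordless {k = k} (P , _) = ∀ (i j : Fin (suc k)) →
    vertex P (toℕ i) ~ vertex P (toℕ j) → Consecutive (suc k) (toℕ i) (toℕ j)

  Chordless⇒InducedCycle : ∀ {U} m (C : Cycle U (3 + m)) → Chordless C → InducedCycle G m
  Chordless⇒InducedCycle m C@(P , _) chordless = vertex P ∘ toℕ , injective′ , λ i j →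
    Consecutive⇒CycAdj m ∘ chordless i j ,
    [ successor-edge C (index≤ j) , ~-sym ∘ successor-edge C (index≤ i) ] ∘ CycAdj⇒Consecutive m
    where
    index≤ : (i : Fin (4 + m)) → toℕ i ≤ 3 + m
    index≤ i = ≤-pred (toℕ<n i)
    injective′ : Injective _≡_ _≡_ (vertex P ∘ toℕ)
    injective′ {i} {j} eq = toℕ-injective (injective P (index≤ i) (index≤ j) eq)

  LowerNeighboursAdjacent : Set
  LowerNeighboursAdjacent =
    ∀ {u v w} → v ~ u → w ~ u → toℕ v < toℕ u → toℕ w < toℕ u → v ≢ w → v ~ w

  -- On a cycle, the two neighbours of the vertex coming last in the order would be joined by a chord.
  LowerNeighboursAdjacent⇒Chordal : LowerNeighboursAdjacent → Chordal G
  LowerNeighboursAdjacent⇒Chordal lower-adjacent m (c , c-injective , c-adj) = last (argmax (toℕ ∘ c))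
    where
    last : (∃ λ i → ∀ j → toℕ (c j) ≤ toℕ (c i)) → ⊥
    last (i , i-last) = chord (cycle-neighbours m i)
      where
      earlier : ∀ {x} → c x ~ c i → toℕ (c x) < toℕ (c i)
      earlier {x} cx~ci = ≤∧≢⇒< (i-last x) (~⇒≢ cx~ci ∘ toℕ-injective)
      chord : (∃₂ λ p q → CycAdj m p i × CycAdj m i q × p ≢ q × ¬ CycAdj m p q) → ⊥
      chord (p , q , p–i , i–q , p≢q , p≁q) = p≁q (proj₁ (c-adj p q)
        (lower-adjacent cp~ci cq~ci (earlier cp~ci) (earlier cq~ci) (p≢q ∘ c-injective)))
        where
        cp~ci : c p ~ c i
        cp~ci = proj₂ (c-adj p i) p–i
        cq~ci : c q ~ c i
        cq~ci = ~-sym (proj₂ (c-adj i q) i–q)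

  -- Large sparse subsets

  -- The end blocks of a graph whose blocks are single edges and triangles.
  data LeafBlock (W : Subset n) : Set where
    isolated : ∀ {v} → v ∈ W → (∀ {x} → x ∈ W → ¬ v ~ x) → LeafBlock W
    pendant  : ∀ {v u} → v ∈ W → u ∈ W → v ~ u → (∀ {x} → x ∈ W → v ~ x → x ≡ u) → LeafBlock W
    ear      : ∀ {a b c} → a ∈ W → b ∈ W → c ∈ W → a ~ b →
               (∀ {x} → x ∈ W → a ~ x → x ≡ b ⊎ x ≡ c) →
               (∀ {x} → x ∈ W → b ~ x → x ≡ a ⊎ x ≡ c) → LeafBlock W

  record LargeSparseSubset (W : Subset n) : Set where
    field
      S      : Subset n
      S⊆W    : S ⊆ W
      sparse : Sparse G 1 S
      large  : ∣ W ∣ < 2 * ∣ S ∣ ⊎ ∣ W ∣ ≡ 0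

  peel : ∀ {W} (R B : Subset n) → R ⊆ W → B ⊆ R → ∣ B ∣ ≤ 2 →
         (∀ {x y} → x ∈ B → y ∈ W ─ R → ¬ x ~ y) → LargeSparseSubset (W ─ R) →
         ∣ R ∣ < 2 * ∣ B ∣ ⊎ (∣ R ∣ ≤ 2 * ∣ B ∣ × ∣ W ─ R ∣ ≢ 0) → LargeSparseSubset W
  peel {W} R B R⊆W B⊆R ∣B∣≤2 B-isolated X gain = record
    { S      = S ∪ B
    ; S⊆W    = ∪⊆ (p─q⊆p W R ∘ S⊆W) (R⊆W ∘ B⊆R)
    ; sparse = Sparse-∪ sparse (∣S∣≤2⇒Sparse ∣B∣≤2) λ x∈S y∈B x~y → B-isolated y∈B (S⊆W x∈S) (~-sym x~y)
    ; large  = inj₁ (begin-strict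
        ∣ W ∣                   ≤⟨ ∣p∣≤∣p─q∣+∣q∣ W R ⟩
        ∣ W ─ R ∣ + ∣ R ∣       <⟨ w+r<2*[s+b] {s = ∣ S ∣} {∣ B ∣} large gain ⟩
        2 * (∣ S ∣ + ∣ B ∣)     ≡⟨ cong (2 *_) (∣p∪q∣≡∣p∣+∣q∣ disjoint) ⟨
        2 * ∣ S ∪ B ∣           ∎)
    }
    where
    open LargeSparseSubset X
    open ≤-Reasoning
    disjoint : ∀ {x} → x ∈ S → x ∉ B
    disjoint x∈S x∈B = x∈p─q⇒x∉q W R (S⊆W x∈S) (B⊆R x∈B)

  SmallerSolved : Subset n → Set
  SmallerSolved W = ∀ {R x} → x ∈ W → x ∈ R → LargeSparseSubset (W ─ R)

  peel-isolated : ∀ {W v} → v ∈ W → (∀ {x} → x ∈ W → ¬ v ~ x) → SmallerSolved W → LargeSparseSubset W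
  peel-isolated {W} {v} v∈W v-isolated rest =
    peel ⁅ v ⁆ ⁅ v ⁆ (⁅x⁆⊆ v∈W) (λ x∈ → x∈) (≤-trans (≤-reflexive (∣⁅x⁆∣≡1 v)) (s≤s z≤n))
      (λ x∈⁅v⁆ y∈W─R → subst (λ x → ¬ x ~ _) (sym (x∈⁅y⁆⇒x≡y v x∈⁅v⁆)) (v-isolated (p─q⊆p W _ y∈W─R)))
      (rest v∈W (x∈⁅x⁆ v))
      (inj₁ (subst (λ s → s < 2 * s) (sym (∣⁅x⁆∣≡1 v)) (s≤s (s≤s z≤n))))

  peel-pendant : ∀ {W v u} → v ∈ W → u ∈ W → v ~ u → (∀ {x} → x ∈ W → v ~ x → x ≡ u) →
                 SmallerSolved W → LargeSparseSubset W
  peel-pendant {W} {v} {u} v∈W u∈W v~u only-u rest = keep (∣ W ─ R ∣ ≟ℕ 0)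
    where
    R : Subset n
    R = ⁅ v ⁆ ∪ ⁅ u ⁆
    R⊆W : R ⊆ W
    R⊆W = ∪⊆ (⁅x⁆⊆ v∈W) (⁅x⁆⊆ u∈W)
    v∈R : v ∈ R
    v∈R = x∈p∪q⁺ (inj₁ (x∈⁅x⁆ v))
    ∣R∣≡2 : ∣ R ∣ ≡ 2
    ∣R∣≡2 = ∣⁅x⁆∪⁅y⁆∣≡2 (~⇒≢ v~u)
    v-isolated : ∀ {x y} → x ∈ ⁅ v ⁆ → y ∈ W ─ R → ¬ x ~ y
    v-isolated x∈⁅v⁆ y∈W─R x~y with x∈⁅y⁆⇒x≡y v x∈⁅v⁆
    ... | refl with only-u (p─q⊆p W R y∈W─R) x~y
    ...   | refl = x∈p─q⇒x∉q W R y∈W─R (x∈p∪q⁺ (inj₂ (x∈⁅x⁆ u)))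

    keep : Dec (∣ W ─ R ∣ ≡ 0) → LargeSparseSubset W
    keep (yes ∣W─R∣≡0) = peel R R R⊆W (λ x∈ → x∈) (≤-reflexive ∣R∣≡2)
      (λ _ y∈W─R → contradiction ∣W─R∣≡0 (>⇒≢ (x∈p⇒0<∣p∣ y∈W─R)))
      (rest v∈W v∈R)
      (inj₁ (subst (λ r → r < 2 * r) (sym ∣R∣≡2) (s≤s (s≤s (s≤s z≤n)))))
    keep (no ∣W─R∣≢0) = peel R ⁅ v ⁆ R⊆W (⁅x⁆⊆ v∈R) (≤-trans (≤-reflexive (∣⁅x⁆∣≡1 v)) (s≤s z≤n))
      v-isolated (rest v∈W v∈R)
      (inj₂ (subst₂ (λ r s → r ≤ 2 * s) (sym ∣R∣≡2) (sym (∣⁅x⁆∣≡1 v)) ≤-refl , ∣W─R∣≢0))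

  peel-ear : ∀ {W a b c} → a ∈ W → b ∈ W → c ∈ W → a ~ b →
             (∀ {x} → x ∈ W → a ~ x → x ≡ b ⊎ x ≡ c) → (∀ {x} → x ∈ W → b ~ x → x ≡ a ⊎ x ≡ c) →
             SmallerSolved W → LargeSparseSubset W
  peel-ear {W} {a} {b} {c} a∈W b∈W c∈W a~b a-neighbours b-neighbours rest =
    peel R B R⊆W B⊆R (≤-reflexive ∣B∣≡2) B-isolated (rest a∈W a∈R)
      (inj₁ (subst (∣ R ∣ <_) (cong (2 *_) (sym ∣B∣≡2)) (s≤s ∣R∣≤3)))
    where
    B R : Subset n
    B = ⁅ a ⁆ ∪ ⁅ b ⁆
    R = ⁅ a ⁆ ∪ ⁅ b ⁆ ∪ ⁅ c ⁆
    a∈R : a ∈ R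
    a∈R = x∈p∪q⁺ (inj₁ (x∈⁅x⁆ a))
    b∈R : b ∈ R
    b∈R = x∈p∪q⁺ (inj₂ (x∈p∪q⁺ (inj₁ (x∈⁅x⁆ b))))
    c∈R : c ∈ R
    c∈R = x∈p∪q⁺ (inj₂ (x∈p∪q⁺ (inj₂ (x∈⁅x⁆ c))))
    R⊆W : R ⊆ W
    R⊆W = ∪⊆ (⁅x⁆⊆ a∈W) (∪⊆ (⁅x⁆⊆ b∈W) (⁅x⁆⊆ c∈W))
    B⊆R : B ⊆ R
    B⊆R = ∪⊆ (⁅x⁆⊆ a∈R) (⁅x⁆⊆ b∈R)
    ∣B∣≡2 : ∣ B ∣ ≡ 2
    ∣B∣≡2 = ∣⁅x⁆∪⁅y⁆∣≡2 (~⇒≢ a~b)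
    ∣R∣≤3 : ∣ R ∣ ≤ 3
    ∣R∣≤3 = ≤-trans (∣p∪q∣≤∣p∣+∣q∣ ⁅ a ⁆ _) (≤-trans (+-monoʳ-≤ ∣ ⁅ a ⁆ ∣ (∣p∪q∣≤∣p∣+∣q∣ ⁅ b ⁆ ⁅ c ⁆))
              (≤-reflexive (cong₂ _+_ (∣⁅x⁆∣≡1 a) (cong₂ _+_ (∣⁅x⁆∣≡1 b) (∣⁅x⁆∣≡1 c)))))
    ∉W─R : ∀ {y} → y ∈ R → y ∉ W ─ R
    ∉W─R y∈R y∈W─R = x∈p─q⇒x∉q W R y∈W─R y∈R
    B-isolated : ∀ {x y} → x ∈ B → y ∈ W ─ R → ¬ x ~ y
    B-isolated x∈B y∈W─R x~y with x∈p∪q⁻ ⁅ a ⁆ ⁅ b ⁆ x∈B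
    ... | inj₁ x∈⁅a⁆ with x∈⁅y⁆⇒x≡y a x∈⁅a⁆
    ...   | refl = [ (λ { refl → ∉W─R b∈R y∈W─R }) , (λ { refl → ∉W─R c∈R y∈W─R }) ]
                     (a-neighbours (p─q⊆p W R y∈W─R) x~y)
    B-isolated x∈B y∈W─R x~y | inj₂ x∈⁅b⁆ with x∈⁅y⁆⇒x≡y b x∈⁅b⁆
    ...   | refl = [ (λ { refl → ∉W─R a∈R y∈W─R }) , (λ { refl → ∉W─R c∈R y∈W─R }) ]
                     (b-neighbours (p─q⊆p W R y∈W─R) x~y)

  peel-leaf : ∀ {W} → LeafBlock W → SmallerSolved W → LargeSparseSubset W
  peel-leaf (isolated v∈W v-isolated)           = peel-isolated v∈W v-isolated
  peel-leaf (pendant v∈W u∈W v~u only-u)        = peel-pendant v∈W u∈W v~u only-u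
  peel-leaf (ear a∈W b∈W c∈W a~b a-nbrs b-nbrs) = peel-ear a∈W b∈W c∈W a~b a-nbrs b-nbrs

  sparse-subset-of-size : ∀ j → n ≡ 2 * suc j → LargeSparseSubset full →
                          ∃ λ S′ → ∣ S′ ∣ ≡ 2 + j × Sparse G 1 S′
  sparse-subset-of-size j n≡2+2j X with ⊆-of-size S (*-cancelˡ-< 2 (suc j) ∣ S ∣ 2+2j<2∣S∣)
    where
    open LargeSparseSubset X
    ∣full∣≡2+2j : ∣ full {n} ∣ ≡ 2 * suc j
    ∣full∣≡2+2j = trans (∣⊤∣≡n n) n≡2+2j
    2+2j<2∣S∣ : 2 * suc j < 2 * ∣ S ∣
    2+2j<2∣S∣ with large
    ... | inj₁ lt     = subst (_< 2 * ∣ S ∣) ∣full∣≡2+2j lt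
    ... | inj₂ ∣full∣≡0 = contradiction (trans (sym ∣full∣≡2+2j) ∣full∣≡0) λ ()
  ... | S′ , S′⊆S , ∣S′∣≡2+j = S′ , ∣S′∣≡2+j , Sparse-antitone S′⊆S (LargeSparseSubset.sparse X)

  -- Chordal graphs without 4-cycles

  module _ (chordal : Chordal G) where

    -- A chord of span two lets us drop one vertex; a longer chord cuts off a shorter long cycle.
    long-cycle⇒FourCycle : ∀ {U} m → Cycle U (3 + m) → FourCycle
    long-cycle⇒FourCycle {U} = <-rec (λ m → Cycle U (3 + m) → FourCycle) shorten
      where
      Shorter : ℕ → Set
      Shorter m = ∀ {m′} → m′ < m → Cycle U (3 + m′) → FourCycle

      ordered-chord : ∀ {m} → Shorter (suc m) → (C : Cycle U (4 + m)) → ∀ {a b} → a < b → b ≤ 4 + m →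
                      vertex (proj₁ C) a ~ vertex (proj₁ C) b → ¬ Consecutive (5 + m) a b → FourCycle
      ordered-chord {m} rec C@(P , _) {a} {b} a<b b≤ chord ¬cons = shortcut (b ∸ a)
        (subst (_≤ 4 + m) (sym b∸a+a≡b) b≤)
        (subst (λ x → vertex P a ~ vertex P x) (sym b∸a+a≡b) chord)
        (subst (λ x → ¬ Consecutive (5 + m) a x) (sym b∸a+a≡b) ¬cons)
        where
        b∸a+a≡b : b ∸ a + a ≡ b
        b∸a+a≡b = m∸n+n≡m (<⇒≤ a<b)

        gap≤ : ∀ {e a} → 3 + e + a ≤ 4 + m → ¬ Consecutive (5 + m) a (3 + e + a) → e ≤ m
        gap≤ {e} {zero} le ¬cons with m≤n⇒m<n∨m≡n le
        ... | inj₁ lt = subst (_≤ m) (+-identityʳ e) (≤-pred (≤-pred (≤-pred (≤-pred lt))))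
        ... | inj₂ eq = ⊥-elim (¬cons (inj₂ (inj₂ (cong suc eq , refl))))
        gap≤ {e} {suc a} le _ =
          m+n≤o⇒m≤o e (≤-pred (subst (_≤ suc m) (+-suc e a) (≤-pred (≤-pred (≤-pred le)))))

        shortcut : ∀ d {a} → d + a ≤ 4 + m → vertex P a ~ vertex P (d + a) →
                   ¬ Consecutive (5 + m) a (d + a) → FourCycle
        shortcut 0             _     chord _     = ⊥-elim (~-irrefl chord)
        shortcut 1             _     _     ¬cons = ⊥-elim (¬cons (inj₁ (inj₁ refl)))
        shortcut 2       {a}   bound chord _     = rec (n<1+n m) (bypass C a bound chord)
        shortcut (suc (suc (suc e))) bound chord ¬cons =
          rec (s≤s (gap≤ bound ¬cons)) (chord⇒Cycle P bound chord)

      shorten : ∀ m → Shorter m → Cycle U (3 + m) → FourCycle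
      shorten zero    _   C         = Cycle-3⇒FourCycle C
      shorten (suc m) rec C@(P , _) with any? (λ i → any? λ j →
        (vertex P (toℕ i) ~? vertex P (toℕ j)) ×-dec ¬? (consecutive? (5 + m) (toℕ i) (toℕ j)))
      ... | no ¬chord = ⊥-elim (chordal (suc m) (Chordless⇒InducedCycle (suc m) C chordless))
        where
        chordless : Chordless C
        chordless i j v~v with consecutive? (5 + m) (toℕ i) (toℕ j)
        ... | yes cons  = cons
        ... | no  ¬cons = ⊥-elim (¬chord (i , j , v~v , ¬cons))
      ... | yes (i , j , v~v , ¬cons) with <-cmp (toℕ i) (toℕ j)
      ...   | tri< i<j _ _ = ordered-chord rec C i<j (≤-pred (toℕ<n j)) v~v ¬cons
      ...   | tri≈ _ i≡j _ =
        ⊥-elim (~-irrefl (subst (λ x → vertex P (toℕ i) ~ vertex P x) (sym i≡j) v~v))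
      ...   | tri> _ _ j<i =
        ordered-chord rec C j<i (≤-pred (toℕ<n i)) (~-sym v~v) (¬cons ∘ Sum.swap)

    module _ (no-four : ¬ FourCycle) (W : Subset n) where

      no-long-cycle : ∀ {U m} → ¬ Cycle U (3 + m)
      no-long-cycle = no-four ∘ long-cycle⇒FourCycle _

      OnPath : ∀ {k} → Path W k → Fin n → Set
      OnPath {k} P x = ∃ λ i → i ≤ k × vertex P i ≡ x

      onPath? : ∀ {k} (P : Path W k) x → Dec (OnPath P x)
      onPath? {k} P x = map′
        (λ (i , eq) → toℕ i , ≤-pred (toℕ<n i) , eq)
        (λ (i , i≤k , eq) → fromℕ< (s≤s i≤k) , subst (λ j → vertex P j ≡ x) (sym (toℕ-fromℕ< (s≤s i≤k))) eq)
        (any? λ i → vertex P (toℕ i) ≟ x)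

      path-length< : ∀ {k} → Path W k → k < n
      path-length< P = injective⇒≤ λ {i} {j} eq →
        toℕ-injective (injective P (≤-pred (toℕ<n i)) (≤-pred (toℕ<n j)) eq)

      prepend : ∀ {k} (P : Path W k) {x} → x ∈ W → x ~ vertex P 0 → ¬ OnPath P x → Path W (suc k)
      prepend {k} P {x} x∈W x~head x∉P = record
        { vertex    = vertex′
        ; injective = injective′
        ; edge      = λ { {zero} _ → x~head ; {suc i} i<k → edge P (≤-pred i<k) }
        ; within    = λ { {zero} _ → x∈W ; {suc i} i≤k → within P (≤-pred i≤k) }
        }
        where
        vertex′ : ℕ → Fin n
        vertex′ zero    = x
        vertex′ (suc i) = vertex P i
        injective′ : ∀ {i j} → i ≤ suc k → j ≤ suc k → vertex′ i ≡ vertex′ j → i ≡ j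
        injective′ {zero}  {zero}  _   _   _  = refl
        injective′ {zero}  {suc j} _   j≤k eq = contradiction (j , ≤-pred j≤k , sym eq) x∉P
        injective′ {suc i} {zero}  i≤k _   eq = contradiction (i , ≤-pred i≤k , eq) x∉P
        injective′ {suc i} {suc j} i≤k j≤k eq = cong suc (injective P (≤-pred i≤k) (≤-pred j≤k) eq)

      replace-head : ∀ {k} (P : Path W (suc k)) {y} → y ∈ W → y ~ vertex P 1 → ¬ OnPath P y →
                     Path W (suc k)
      replace-head {k} P y∈W y~u y∉P = prepend (subpath P 1 k (≤-reflexive (+-comm k 1))) y∈W y~u
        λ (i , i≤k , eq) → y∉P (i + 1 , ≤-trans (≤-reflexive (+-comm i 1)) (s≤s i≤k) , eq)

      HeadClosed : ∀ {k} → Path W k → Set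
      HeadClosed P = ∀ {x} → x ∈ W → vertex P 0 ~ x → OnPath P x

      extend-or-closed : ∀ {k} (P : Path W k) → Path W (suc k) ⊎ HeadClosed P
      extend-or-closed P
        with any? (λ x → (x ∈? W) ×-dec (vertex P 0 ~? x) ×-dec ¬? (onPath? P x))
      ... | yes (x , x∈W , head~x , x∉P) = inj₁ (prepend P x∈W (~-sym head~x) x∉P)
      ... | no  ¬out = inj₂ closed
        where
        closed : HeadClosed P
        closed {x} x∈W head~x with onPath? P x
        ... | yes x∈P = x∈P
        ... | no  x∉P = contradiction (x , x∈W , head~x , x∉P) ¬out

      -- A neighbour further along the path would close a cycle of length at least four.
      closed-head-neighbour : ∀ {k} (P : Path W k) → HeadClosed P → ∀ {x} → x ∈ W → vertex P 0 ~ x →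
                              (1 ≤ k × x ≡ vertex P 1) ⊎ (2 ≤ k × x ≡ vertex P 2)
      closed-head-neighbour {k} P closed x∈W head~x with closed x∈W head~x
      ... | 0 , _   , refl = contradiction head~x ~-irrefl
      ... | 1 , 1≤k , refl = inj₁ (1≤k , refl)
      ... | 2 , 2≤k , refl = inj₂ (2≤k , refl)
      ... | suc (suc (suc i)) , 3+i≤k , refl = contradiction
        (chord⇒Cycle P {a = 0} (subst (_≤ k) (sym (+-identityʳ (3 + i))) 3+i≤k)
          (subst (λ j → vertex P 0 ~ vertex P j) (sym (+-identityʳ (3 + i))) head~x))
        no-long-cycle

      -- A further neighbour y of vertex 1 yields a 4-cycle, a longer path, or the pendant edge y, vertex 1.
      third-neighbour : ∀ {k} (P : Path W (suc k)) → HeadClosed P → 2 ≤ suc k →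
                        vertex P 0 ~ vertex P 2 → ∀ {y} → y ∈ W → vertex P 1 ~ y →
                        y ≢ vertex P 0 → y ≢ vertex P 2 → LeafBlock W ⊎ Path W (suc (suc k))
      third-neighbour {k} P closed 2≤1+k h~w {y} y∈W u~y y≢h y≢w with onPath? P y
      ... | yes (0 , _ , y≡h)  = contradiction (sym y≡h) y≢h
      ... | yes (1 , _ , refl) = contradiction u~y ~-irrefl
      ... | yes (2 , _ , y≡w)  = contradiction (sym y≡w) y≢w
      ... | yes (3 , 3≤1+k , refl) = contradiction (record
        { a = vertex P 0 ; b = vertex P 1 ; c = vertex P 3 ; d = vertex P 2
        ; a~b = edge P (s≤s z≤n) ; b~c = u~y ; c~d = ~-sym (edge P 3≤1+k) ; d~a = ~-sym h~w
        ; a≢c = λ eq → contradiction (injective P z≤n 3≤1+k eq) λ ()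
        ; b≢d = λ eq → contradiction (injective P (s≤s z≤n) 2≤1+k eq) λ () }) no-four
      ... | yes (suc (suc (suc (suc i))) , 4+i≤1+k , refl) = contradiction
        (chord⇒Cycle P {a = 1} {d = 3 + i} (≤-trans (≤-reflexive (+-comm (3 + i) 1)) 4+i≤1+k)
          (subst (λ j → vertex P 1 ~ vertex P j) (+-comm 1 (3 + i)) u~y))
        no-long-cycle
      ... | no y∉P with y ~? vertex P 2
      ...   | yes y~w = contradiction (record
        { a = vertex P 0 ; b = vertex P 1 ; c = y ; d = vertex P 2
        ; a~b = edge P (s≤s z≤n) ; b~c = u~y ; c~d = y~w ; d~a = ~-sym h~w
        ; a≢c = y≢h ∘ sym
        ; b≢d = λ eq → contradiction (injective P (s≤s z≤n) 2≤1+k eq) λ () }) no-four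
      ...   | no  y≁w with extend-or-closed (replace-head P y∈W (~-sym u~y) y∉P)
      ...     | inj₁ longer = inj₂ longer
      ...     | inj₂ closed′ = inj₁ (pendant y∈W (within P (s≤s z≤n)) (~-sym u~y) only-u)
        where
        only-u : ∀ {x} → x ∈ W → y ~ x → x ≡ vertex P 1
        only-u x∈W y~x with closed-head-neighbour (replace-head P y∈W (~-sym u~y) y∉P) closed′ x∈W y~x
        ... | inj₁ (_ , x≡u)  = x≡u
        ... | inj₂ (_ , refl) = contradiction y~x y≁w

      at-closed-head : ∀ {k} (P : Path W k) → HeadClosed P → LeafBlock W ⊎ Path W (suc k)
      at-closed-head {zero} P closed = inj₁ (isolated (within P z≤n) no-neighbour)
        where
        no-neighbour : ∀ {x} → x ∈ W → ¬ vertex P 0 ~ x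
        no-neighbour x∈W head~x with closed-head-neighbour P closed x∈W head~x
        ... | inj₁ (() , _)
        ... | inj₂ (() , _)
      at-closed-head {suc k} P closed with (2 ≤? suc k) ×-dec (vertex P 0 ~? vertex P 2)
      ... | no ¬triangle = inj₁ (pendant (within P z≤n) (within P (s≤s z≤n)) (edge P (s≤s z≤n)) only-u)
        where
        only-u : ∀ {x} → x ∈ W → vertex P 0 ~ x → x ≡ vertex P 1
        only-u x∈W head~x with closed-head-neighbour P closed x∈W head~x
        ... | inj₁ (_ , x≡u)      = x≡u
        ... | inj₂ (2≤1+k , refl) = contradiction (2≤1+k , head~x) ¬triangle
      ... | yes (2≤1+k , h~w) with any? (λ y → (y ∈? W) ×-dec (vertex P 1 ~? y) ×-dec
                                                ¬? (y ≟ vertex P 0) ×-dec ¬? (y ≟ vertex P 2))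
      ...   | yes (y , y∈W , u~y , y≢h , y≢w) = third-neighbour P closed 2≤1+k h~w y∈W u~y y≢h y≢w
      ...   | no ¬third = inj₁ (ear (within P z≤n) (within P (s≤s z≤n)) (within P 2≤1+k)
                                    (edge P (s≤s z≤n)) h-neighbours u-neighbours)
        where
        h-neighbours : ∀ {x} → x ∈ W → vertex P 0 ~ x → x ≡ vertex P 1 ⊎ x ≡ vertex P 2
        h-neighbours x∈W h~x = Sum.map proj₂ proj₂ (closed-head-neighbour P closed x∈W h~x)
        u-neighbours : ∀ {x} → x ∈ W → vertex P 1 ~ x → x ≡ vertex P 0 ⊎ x ≡ vertex P 2
        u-neighbours {x} x∈W u~x with x ≟ vertex P 0 | x ≟ vertex P 2
        ... | yes x≡h | _       = inj₁ x≡h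
        ... | no  _   | yes x≡w = inj₂ x≡w
        ... | no  x≢h | no  x≢w = contradiction (x , x∈W , u~x , x≢h , x≢w) ¬third

      explore : ∀ fuel {k} → n ≤ k + fuel → Path W k → LeafBlock W
      explore zero {k} n≤k+0 P = contradiction (subst (n ≤_) (+-identityʳ k) n≤k+0) (<⇒≱ (path-length< P))
      explore (suc fuel) {k} n≤ P with extend-or-closed P
      ... | inj₁ longer = explore fuel (subst (n ≤_) (+-suc k fuel) n≤) longer
      ... | inj₂ closed with at-closed-head P closed
      ...   | inj₁ block  = block
      ...   | inj₂ longer = explore fuel (subst (n ≤_) (+-suc k fuel) n≤) longer

      leaf-block : ∀ {v} → v ∈ W → LeafBlock W
      leaf-block {v} v∈W = explore n ≤-refl (record
        { vertex = λ _ → v ; injective = λ { z≤n z≤n _ → refl } ; edge = λ () ; within = λ _ → v∈W })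

    large-sparse-subset : ¬ FourCycle → ∀ W → LargeSparseSubset W
    large-sparse-subset no-four W = <-rec P step ∣ W ∣ W refl
      where
      P : ℕ → Set
      P k = ∀ W → ∣ W ∣ ≡ k → LargeSparseSubset W

      step : ∀ k → (∀ {k′} → k′ < k → P k′) → P k
      step _ rec W refl with ∣ W ∣ ≟ℕ 0
      ... | yes ∣W∣≡0 = record
        { S = ∅ ; S⊆W = ⊆-min W ; sparse = λ _ v∈∅ → contradiction v∈∅ ∉⊥ ; large = inj₂ ∣W∣≡0 }
      ... | no  ∣W∣≢0 with 0<∣p∣⇒Nonempty (n≢0⇒n>0 ∣W∣≢0)
      ...   | _ , v∈W = peel-leaf (leaf-block no-four W v∈W)
        λ {R} x∈W x∈R → rec (p∩q≢∅⇒∣p─q∣<∣p∣ W R (_ , x∈p∩q⁺ (x∈W , x∈R))) (W ─ R) refl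

-- Upper bound

2*[1+j]∸2≡2*j : ∀ j → 2 * suc j ∸ 2 ≡ 2 * j
2*[1+j]∸2≡2*j j = trans (cong (_∸ 2) (*-suc 2 j)) (m+n∸m≡n 2 (2 * j))

ramsey-upper : ∀ j → 2 ≤ j → RamseyCH 1 4 j (2 * j ∸ 2)
ramsey-upper (suc (suc j)) _ G chordal with fourCycle? G
... | yes C       = inj₁ (FourCycle⇒dense G C)
... | no  no-four = inj₂ (sparse-subset-of-size G j (2*[1+j]∸2≡2*j (suc j))
                           (large-sparse-subset G chordal no-four full))
ramsey-upper 0       ()
ramsey-upper 1       (s≤s ())

-- Lower bound: a chain of triangles

-- H m has vertices 0 … m - 1 and edges 2i ~ 2i + 1, 2i + 1 ~ 2i + 2 and 2i + 1 ~ 2i + 3,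
-- given by link u v for u < v.
link : ℕ → ℕ → Bool
link 0 1 = true
link 1 2 = true
link 1 3 = true
link (suc (suc u)) (suc (suc v)) = link u v
link _ _ = false

link-irrefl : ∀ u → link u u ≡ false
link-irrefl 0             = refl
link-irrefl 1             = refl
link-irrefl (suc (suc u)) = link-irrefl u

link-suc : ∀ u → T (link u (suc u))
link-suc 0             = _
link-suc 1             = _
link-suc (suc (suc u)) = link-suc u

link⇒ : ∀ u v → T (link u v) → v ≡ suc u ⊎ v ≡ suc (suc u)
link⇒ 0 1 _ = inj₁ refl
link⇒ 1 2 _ = inj₁ refl
link⇒ 1 3 _ = inj₂ refl
link⇒ (suc (suc u)) (suc (suc v)) l = Sum.map (cong (2 +_)) (cong (2 +_)) (link⇒ u v l)
link⇒ 0 0 ()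
link⇒ 0 (suc (suc _)) ()
link⇒ 1 0 ()
link⇒ 1 1 ()
link⇒ 1 (suc (suc (suc (suc _)))) ()
link⇒ (suc (suc _)) 0 ()
link⇒ (suc (suc _)) 1 ()

link⇒< : ∀ {u v} → T (link u v) → u < v
link⇒< {u} {v} l with link⇒ u v l
... | inj₁ refl = ≤-refl
... | inj₂ refl = m<n⇒m<1+n (n<1+n u)

H : ∀ m → Graph m
H m = record
  { adj    = λ u v → link (toℕ u) (toℕ v) ∨ link (toℕ v) (toℕ u)
  ; sym    = λ u v → ∨-comm (link (toℕ u) (toℕ v)) _
  ; irrefl = λ v → cong₂ _∨_ (link-irrefl (toℕ v)) (link-irrefl (toℕ v))
  }

H-lower-link : ∀ {m} {u v : Fin m} → _~_ (H m) v u → toℕ v < toℕ u → T (link (toℕ v) (toℕ u))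
H-lower-link {u = u} {v} v~u v<u with Equivalence.to T-∨ v~u
... | inj₁ l = l
... | inj₂ l = contradiction (link⇒< l) (<⇒≯ v<u)

H-lower-neighbours-adjacent : ∀ m → LowerNeighboursAdjacent (H m)
H-lower-neighbours-adjacent m {u} {v} {w} v~u w~u v<u w<u v≢w
  with link⇒ _ _ (H-lower-link v~u v<u) | link⇒ _ _ (H-lower-link w~u w<u)
... | inj₁ u≡1+v | inj₁ u≡1+w = contradiction (toℕ-injective (suc-injective (trans (sym u≡1+v) u≡1+w))) v≢w
... | inj₂ u≡2+v | inj₂ u≡2+w =
  contradiction (toℕ-injective (suc-injective (suc-injective (trans (sym u≡2+v) u≡2+w)))) v≢w
... | inj₁ u≡1+v | inj₂ u≡2+w = Equivalence.from T-∨ (inj₂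
  (subst (T ∘ link (toℕ w)) (suc-injective (trans (sym u≡2+w) u≡1+v)) (link-suc (toℕ w))))
... | inj₂ u≡2+v | inj₁ u≡1+w = Equivalence.from T-∨ (inj₁
  (subst (T ∘ link (toℕ v)) (suc-injective (trans (sym u≡2+v) u≡1+w)) (link-suc (toℕ v))))

front : ∀ {m} → Subset m → Bool
front []          = false
front (x ∷ [])    = x
front (x ∷ y ∷ _) = x ∨ y

Sparse-tail : ∀ {m a b} {S : Subset m} → Sparse (H (2 + m)) 1 (a ∷ b ∷ S) → Sparse (H m) 1 S
Sparse-tail {m} {a} {b} {S} sparse v v∈S =
  ≤-trans (∣p∣≤∣x∷p∣ b′ (S ∩ Nbhd (H m) v))
          (≤-trans (∣p∣≤∣x∷p∣ a′ (b′ ∷ S ∩ Nbhd (H m) v)) (sparse v′ (there (there v∈S))))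
  where
  v′ : Fin (2 + m)
  v′ = suc (suc v)
  a′ b′ : Bool
  a′ = a ∧ adj (H (2 + m)) v′ zero
  b′ = b ∧ adj (H (2 + m)) v′ (suc zero)

-- Vertex 1 is adjacent to 0, 2 and 3.
Sparse-full-pair : ∀ {m} (S : Subset m) → Sparse (H (2 + m)) 1 (inside ∷ inside ∷ S) → front S ≡ false
Sparse-full-pair []                      _      = refl
Sparse-full-pair (outside ∷ [])          _      = refl
Sparse-full-pair (outside ∷ outside ∷ _) _      = refl
Sparse-full-pair (inside ∷ [])           sparse = contradiction (sparse (suc zero) (there here)) λ { (s≤s ()) }
Sparse-full-pair (inside ∷ _ ∷ _)        sparse = contradiction (sparse (suc zero) (there here)) λ { (s≤s ()) }
Sparse-full-pair (outside ∷ inside ∷ _)  sparse = contradiction (sparse (suc zero) (there here)) λ { (s≤s ()) }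

-- Each pair {2i, 2i + 1} holds at most two vertices of S, and a full pair is followed by an empty one.
Sparse⇒bound : ∀ {m} (S : Subset m) → Sparse (H m) 1 S →
               2 * ∣ S ∣ ≤ m + 2 × (front S ≡ false → 2 * ∣ S ∣ ≤ m)
Sparse⇒bound []             _ = z≤n , λ _ → z≤n
Sparse⇒bound (outside ∷ []) _ = z≤n , λ _ → z≤n
Sparse⇒bound (inside ∷ [])  _ = s≤s (s≤s z≤n) , λ ()
Sparse⇒bound {suc (suc m)} (a ∷ b ∷ S) sparse with Sparse⇒bound S (Sparse-tail sparse)
... | bound , bound-if-free = pair a b sparse
  where
  s : ℕ
  s = ∣ S ∣
  pair : ∀ a b → Sparse (H (2 + m)) 1 (a ∷ b ∷ S) →
         2 * ∣ a ∷ b ∷ S ∣ ≤ 2 + m + 2 × (front (a ∷ b ∷ S) ≡ false → 2 * ∣ a ∷ b ∷ S ∣ ≤ 2 + m)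
  pair outside outside _ =
    ≤-trans bound (≤-trans (n≤1+n _) (n≤1+n _)) , λ _ → subst (2 * s ≤_) (+-comm m 2) bound
  pair outside inside  _ = subst (_≤ 2 + m + 2) (sym (*-suc 2 s)) (s≤s (s≤s bound)) , λ ()
  pair inside  outside _ = subst (_≤ 2 + m + 2) (sym (*-suc 2 s)) (s≤s (s≤s bound)) , λ ()
  pair inside  inside  full-pair =
    subst (_≤ 2 + m + 2) (sym (trans (*-suc 2 (suc s)) (cong (2 +_) (*-suc 2 s))))
      (s≤s (s≤s (subst (2 + 2 * s ≤_) (+-comm 2 m)
        (s≤s (s≤s (bound-if-free (Sparse-full-pair S full-pair))))))) , λ ()

⌊suc≟suc⌋ : ∀ {m} (x y : Fin m) → ⌊ suc x ≟ suc y ⌋ ≡ ⌊ x ≟ y ⌋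
⌊suc≟suc⌋ x y with x ≟ y
... | yes _ = refl
... | no  _ = refl

Dense-tail : ∀ {m} {S : Subset m} → Dense (H (2 + m)) 1 (outside ∷ outside ∷ S) → Dense (H m) 1 S
Dense-tail {S = S} dense v v∈S = subst (_≤ 1) (cong (λ N → ∣ S ∩ N ∣) (tabulate-cong λ u →
    cong (λ b → not (adj (H _) v u) ∧ not b) (trans (⌊suc≟suc⌋ (suc u) (suc v)) (⌊suc≟suc⌋ u v))))
  (dense (suc (suc v)) (there (there v∈S)))

no-single-neighbour : ∀ {m} {S : Subset m} {v} (u : Fin m) → Dense (H m) 1 S → ∣ S ∣ ≡ 4 → v ∈ S →
                      ¬ (∀ {x} → x ∈ S → _~_ (H m) v x → x ≡ u)
no-single-neighbour {S = S} {v} u dense ∣S∣≡4 v∈S only-u =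
  contradiction (subst (_≤ 3) ∣S∣≡4 (≤-trans (Dense⇒∣S∣≤2+degree (H _) dense v∈S) (s≤s (s≤s (∣p∣≤1 u λ x∈ →
    let x∈S , x∈N = x∈p∩q⁻ S _ x∈ in only-u x∈S (∈Nbhd⁻ (H _) x∈N))))))
  λ { (s≤s (s≤s (s≤s ()))) }

neighbours-of-0 : ∀ {m} {x : Fin (2 + m)} → _~_ (H (2 + m)) zero x → x ≡ suc zero
neighbours-of-0 {x = suc zero} _ = refl
neighbours-of-0 {x = zero} ()
neighbours-of-0 {x = suc (suc _)} ()

neighbours-of-1 : ∀ {m} {x : Fin (4 + m)} → _~_ (H (4 + m)) (suc zero) x →
                  x ≡ zero ⊎ x ≡ suc (suc zero) ⊎ x ≡ suc (suc (suc zero))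
neighbours-of-1 {x = zero}                      _ = inj₁ refl
neighbours-of-1 {x = suc (suc zero)}            _ = inj₂ (inj₁ refl)
neighbours-of-1 {x = suc (suc (suc zero))}      _ = inj₂ (inj₂ refl)
neighbours-of-1 {x = suc zero}                  ()
neighbours-of-1 {x = suc (suc (suc (suc _)))}   ()

-- A 1-dense 4-set gives every member two neighbours in it; look at its first member.
no-dense-4-set : ∀ {m} (S : Subset m) → ∣ S ∣ ≡ 4 → ¬ Dense (H m) 1 S
no-dense-4-set (outside ∷ outside ∷ S) ∣S∣≡4 dense = no-dense-4-set S ∣S∣≡4 (Dense-tail dense)
no-dense-4-set (inside ∷ b ∷ S) ∣S∣≡4 dense =
  no-single-neighbour (suc zero) dense ∣S∣≡4 here λ {x} _ 0~x → neighbours-of-0 {x = x} 0~x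
no-dense-4-set {suc (suc (suc (suc m)))} (outside ∷ inside ∷ outside ∷ d ∷ S) ∣S∣≡4 dense =
  no-single-neighbour (suc (suc (suc zero))) dense ∣S∣≡4 (there here) only-3
  where
  only-3 : ∀ {x} → x ∈ outside ∷ inside ∷ outside ∷ d ∷ S → _~_ (H (4 + m)) (suc zero) x →
           x ≡ suc (suc (suc zero))
  only-3 {x} x∈S 1~x with neighbours-of-1 {x = x} 1~x
  ... | inj₁ refl = contradiction x∈S λ ()
  ... | inj₂ (inj₁ refl) = contradiction x∈S λ { (there (there ())) }
  ... | inj₂ (inj₂ x≡3) = x≡3
no-dense-4-set {suc (suc (suc (suc m)))} (outside ∷ inside ∷ c ∷ outside ∷ S) ∣S∣≡4 dense =
  no-single-neighbour (suc (suc zero)) dense ∣S∣≡4 (there here) only-2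
  where
  only-2 : ∀ {x} → x ∈ outside ∷ inside ∷ c ∷ outside ∷ S → _~_ (H (4 + m)) (suc zero) x →
           x ≡ suc (suc zero)
  only-2 {x} x∈S 1~x with neighbours-of-1 {x = x} 1~x
  ... | inj₁ refl = contradiction x∈S λ ()
  ... | inj₂ (inj₁ x≡2) = x≡2
  ... | inj₂ (inj₂ refl) = contradiction x∈S λ { (there (there (there ()))) }
-- Here the fourth member 4 + w is adjacent to neither 1 nor 2.
no-dense-4-set (outside ∷ inside ∷ inside ∷ inside ∷ S) ∣S∣≡4 dense
  with 0<∣p∣⇒Nonempty (subst (0 <_) (sym (suc-injective (suc-injective (suc-injective ∣S∣≡4)))) (s≤s z≤n))
... | w , w∈S = contradiction (dense (suc (suc (suc (suc w)))) (there (there (there (there w∈S)))))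
  λ { (s≤s ()) }
no-dense-4-set [] ()
no-dense-4-set (outside ∷ []) ()
no-dense-4-set (outside ∷ inside ∷ []) ()
no-dense-4-set (outside ∷ inside ∷ outside ∷ []) ()
no-dense-4-set (outside ∷ inside ∷ inside ∷ []) ()

ramsey-lower : ∀ j m → m + 2 < 2 * j → ¬ RamseyCH 1 4 j m
ramsey-lower j m m+2<2j ramsey
  with ramsey (H m) (LowerNeighboursAdjacent⇒Chordal (H m) (H-lower-neighbours-adjacent m))
... | inj₁ (S , ∣S∣≡4 , dense)  = no-dense-4-set S ∣S∣≡4 dense
... | inj₂ (S , ∣S∣≡j , sparse) =
  <⇒≱ m+2<2j (subst (λ s → 2 * s ≤ m + 2) ∣S∣≡j (proj₁ (Sparse⇒bound S sparse)))

theorem5p2 : ∀ (j : ℕ) → 3 ≤ j → RCH≡ 1 4 j (2 * j ∸ 2)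
theorem5p2 j 3≤j = ramsey-upper j (≤-trans (n≤1+n 2) 3≤j) , λ m m<2j∸2 → ramsey-lower j m
  (subst (m + 2 <_) (m∸n+n≡m (*-monoʳ-≤ 2 (≤-trans (s≤s z≤n) 3≤j))) (+-monoˡ-< 2 m<2j∸2))
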